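{- An integer sequence $(a_n)$ is a strong Euler–Gauss sequence if and only if for all primes $p$ and integers $r\ge1$, $m\ge1$, $\left(\frac{a_{p^rm}}{\gcd(a_{p^rm},a_{p^{r-1}m})}\right)^{ -1}\equiv\left(\frac{a_{p^{r-1}m}}{\gcd(a_{p^rm},a_{p^{r-1}m})}\right)^{ -1}\pmod{p^r}$ (the inverses being modulo $p^r$, which in particular exist).
   Context: $\mu$ is the Möbius function. For an integer sequence $(a_n)$ let $A_n^+=\prod_{d\mid n,\ \mu(d)=1} a_{n/d}$ and $A_n^-=\prod_{d\mid n,\ \mu(d)=-1} a_{n/d}$ (empty products equal $1$). $(a_n)$ is a strong Euler–Gauss sequence if for every $n\ge1$ the integers $A_n^+/\gcd(A_n^+,A_n^-)$ and $A_n^-/\gcd(A_n^+,A_n^-)$ are invertible modulo $n$ and $\left(\frac{A_n^- }{\gcd(A_n^+,A_n^-)}\right)^{ -1}\equiv\left(\frac{A_n^+}{\gcd(A_n^+,A_n^-)}\right)^{ -1}\pmod n$. -}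

module Defs where

open import Data.Nat as ℕ using (ℕ; zero; suc; _∸_; _^_)
open import Data.Nat.Divisibility using (_∣?_)
open import Data.Nat.Primality using (prime?)
open import Data.Integer as ℤ using (ℤ; +_; -[1+_]; +[1+_]; _*_; _-_)
open import Data.Integer.Divisibility as ℤD using ()
open import Data.Integer.GCD using (gcd)
open import Data.List using (List; upTo; foldr; map; filter)
open import Data.Product using (Σ; _×_)
open import Relation.Nullary using (Dec; yes; no; does)
open import Data.Bool using (if_then_else_)

-- For n ≥ 1 this is 0 if n is not squarefree, (-1)^k if n is a product of k distinct primes.
μ-factor : ℕ → ℕ → ℤ
μ-factor n p with prime? p
... | no _ = + 1
... | yes _ with (p ^ 2) ∣? n
...   | yes _ = + 0
...   | no _ with p ∣? n
...     | yes _ = -[1+ 0 ]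
...     | no _ = + 1

μ : ℕ → ℤ
μ n = foldr (λ i acc → μ-factor n (suc i) * acc) (+ 1) (upTo n)

prodℤ : List ℤ → ℤ
prodℤ = foldr _*_ (+ 1)





-- A_n^+ = ∏_{d ∣ n, μ(d) = 1} a_{n/d}
A⁺ : (ℕ → ℤ) → ℕ → ℤ
A⁺ a n = foldr (λ i acc → if does (μ (suc i) ℤ.≟ + 1) then a (n ℕ./ suc i) * acc else acc)
               (+ 1) (filter (λ i → suc i ∣? n) (upTo n))

A⁻ : (ℕ → ℤ) → ℕ → ℤ
A⁻ a n = foldr (λ i acc → if does (μ (suc i) ℤ.≟ -[1+ 0 ]) then a (n ℕ./ suc i) * acc else acc)
               (+ 1) (filter (λ i → suc i ∣? n) (upTo n))

-- exact division x / g (g = gcd, so g ∣ x); convention: x / 0 = 0 (only arises when x = 0)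
infixl 7 _÷_
_÷_ : ℤ → ℤ → ℤ
x ÷ (+ zero) = + 0
x ÷ g@(+[1+ k ]) = x ℤ./ g
x ÷ g@(-[1+ k ]) = x ℤ./ g

infix 4 _≡_[mod_]
_≡_[mod_] : ℤ → ℤ → ℕ → Set
x ≡ y [mod n ] = (+ n) ℤD.∣ (x - y)

InvCong : ℕ → ℤ → ℤ → Set
InvCong n x y = Σ ℤ λ u → Σ ℤ λ v →
  (x * u ≡ + 1 [mod n ]) × (y * v ≡ + 1 [mod n ]) × (u ≡ v [mod n ])

-- strong Euler–Gauss sequence (a_n indexed by n ≥ 1; a 0 is irrelevant)
StrongEG : (ℕ → ℤ) → Set
StrongEG a = (n : ℕ) → 1 ℕ.≤ n →
  InvCong n (A⁻ a n ÷ gcd (A⁺ a n) (A⁻ a n)) (A⁺ a n ÷ gcd (A⁺ a n) (A⁻ a n))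

{-# OPTIONS --safe #-}
-- Write x ∼ y (mod N) when x s = y t for units s ≡ t (mod N). This relation is compatible with
-- products and cancellable by nonzero factors, and for x ≠ 0 it says exactly that x / gcd(x, y) and
-- y / gcd(x, y) are units with congruent inverses. For n = p^(r+1) m with p ∤ m, the divisors d of n
-- with μ(d) ≠ 0 are the d and d p with d ∣ m, and μ(d p) = −μ(d); so with B k = a(p^(r+1) k) and
-- C k = a(p^r k), A⁺_n is the product of the B(m / d) over μ(d) = 1 and of the C(m / d) over
-- μ(d) = −1, and A⁻_n the same with B and C exchanged.
-- If B k ∼ C k modulo p^(r+1) for all k, then A⁺_n ∼ A⁻_n modulo every prime power exactly
-- dividing n, and these combine by the Chinese remainder theorem. Conversely, by strong induction on
-- m the factors for d ≥ 2 agree up to units and cancel from A⁺_n ∼ A⁻_n, leaving B m ∼ C m; a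
-- general m reduces to p ∤ m by absorbing its p-part into r. Both conditions force a(k) ≠ 0 for
-- k ≥ 1, which makes the cancellation possible.
module Submission where

open import Level using (0ℓ)
open import Data.Bool.Base using (true; false; if_then_else_)
open import Data.Empty using (⊥-elim)
open import Data.Integer.Base
  using (ℤ; +_; +[1+_]; -[1+_]; 0ℤ; 1ℤ; -1ℤ; _+_; _*_; _-_; -_; ∣_∣; NonZero; ≢-nonZero)
import Data.Integer.DivMod as ℤ
import Data.Integer.Divisibility.Signed as ℤ∣
open import Data.Integer.GCD using (gcd; gcd[i,j]∣i; gcd[i,j]∣j; gcd[i,j]≡0⇒i≡0)
open import Data.Integer.Properties
  using ( _≟_; pos-+; pos-*; +-comm; *-comm; *-assoc; *-identityˡ; *-identityʳ; *-zeroʳ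
        ; +-identityˡ; -1*i≡-i; neg-involutive; i*j≡0⇒i≡0∨j≡0; *-cancelˡ-≡; *-cancelʳ-≡
        ; +∣i∣≡i⊎+∣i∣≡-i)
open import Data.Integer.Tactic.RingSolver using (solve-∀)
open import Data.List.Base using ([]; _∷_; foldr; filter; applyUpTo; upTo)
open import Data.List.Relation.Unary.All using (_∷_)
open import Data.Nat.Base as ℕ using (ℕ; zero; suc; _^_; _/_)
open import Data.Nat.Coprimality using (Coprime; coprime-divisor)
import Data.Nat.Coprimality as Coprimality
open import Data.Nat.Divisibility using (_∣_; _∣?_; divides)
import Data.Nat.Divisibility as ℕ∣
import Data.Nat.DivMod as ℕ
open import Data.Nat.GCD using (module Bézout)
import Data.Nat.GCD as ℕ
open import Data.Nat.Induction using (<-rec)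
open import Data.Nat.ListAction using (product)
open import Data.Nat.Primality
  using ( Prime; prime?; prime[2]; prime⇒irreducible; prime⇒nonZero; prime⇒nonTrivial
        ; ¬prime[0]; ¬prime[1]; euclidsLemma)
open import Data.Nat.Primality.Factorisation using (factorise)
import Data.Nat.Properties as ℕ
open import Data.Nat.Tactic.RingSolver renaming (solve-∀ to ℕ-solve-∀)
open import Data.Product using (Σ; _×_; _,_; proj₁; proj₂; map₁)
open import Data.Sum using (inj₁; inj₂)
open import Function.Base using (_∘_; id)
open import Function.Bundles using (_⇔_; mk⇔; module Equivalence)
open import Relation.Binary.Bundles using (Setoid)
open import Relation.Binary.PropositionalEquality
  using (_≡_; _≢_; refl; sym; trans; cong; cong₂; subst; subst₂; module ≡-Reasoning)
import Relation.Binary.Reasoning.Setoid as SetoidReasoning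
open import Relation.Binary.Structures using (IsEquivalence)
open import Relation.Nullary using (¬_; Dec; yes; no; does; ¬?)
open import Relation.Nullary.Decidable using (dec-true; dec-false; _×-dec_)
open import Relation.Unary using (Pred; Decidable)

open import Defs

private variable
  M N d i j m n p q r : ℕ
  s s′ u v w x y z x₁ y₁ : ℤ
  a b c f g : ℕ → ℤ
  P : Pred ℕ 0ℓ

-- Congruence modulo N

-- A record version of `_≡_[mod_]` (via signed divisibility), so that x, y and N are inferable.
infix 4 _≈_[mod_]
record _≈_[mod_] (x y : ℤ) (N : ℕ) : Set where
  constructor mk≈
  field modulus∣difference : + N ℤ∣.∣ (x - y)

≈⇒≡[mod] : x ≈ y [mod N ] → x ≡ y [mod N ]
≈⇒≡[mod] (mk≈ N∣x-y) = ℤ∣.∣⇒∣ᵤ N∣x-y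

≡[mod]⇒≈ : x ≡ y [mod N ] → x ≈ y [mod N ]
≡[mod]⇒≈ N∣x-y = mk≈ (ℤ∣.∣ᵤ⇒∣ N∣x-y)

≈-reflexive : x ≡ y → x ≈ y [mod N ]
≈-reflexive {x = x} {N = N} refl = mk≈ (ℤ∣.divides 0ℤ (x-x≡0*N x (+ N)))
  where
  x-x≡0*N : ∀ x n → x - x ≡ 0ℤ * n
  x-x≡0*N = solve-∀

≈-refl : x ≈ x [mod N ]
≈-refl = ≈-reflexive refl

≈-sym : x ≈ y [mod N ] → y ≈ x [mod N ]
≈-sym {x = x} {y = y} (mk≈ N∣x-y) = mk≈ (subst (_ ℤ∣.∣_) (-[x-y]≡y-x x y) (ℤ∣.∣m⇒∣-m N∣x-y))
  where
  -[x-y]≡y-x : ∀ x y → - (x - y) ≡ y - x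
  -[x-y]≡y-x = solve-∀

≈-trans : x ≈ y [mod N ] → y ≈ z [mod N ] → x ≈ z [mod N ]
≈-trans {x = x} {y = y} {z = z} (mk≈ N∣x-y) (mk≈ N∣y-z) =
  mk≈ (subst (_ ℤ∣.∣_) (telescope x y z) (ℤ∣.∣m∣n⇒∣m+n N∣x-y N∣y-z))
  where
  telescope : ∀ x y z → (x - y) + (y - z) ≡ x - z
  telescope = solve-∀

≈-*-cong : x ≈ y [mod N ] → x₁ ≈ y₁ [mod N ] → x * x₁ ≈ y * y₁ [mod N ]
≈-*-cong {x = x} {y = y} {x₁ = x₁} {y₁ = y₁} (mk≈ N∣x-y) (mk≈ N∣x₁-y₁) =
  mk≈ (subst (_ ℤ∣.∣_) (split x y x₁ y₁)
    (ℤ∣.∣m∣n⇒∣m+n (ℤ∣.∣m⇒∣m*n x₁ N∣x-y) (ℤ∣.∣n⇒∣m*n y N∣x₁-y₁)))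
  where
  split : ∀ x y x₁ y₁ → (x - y) * x₁ + y * (x₁ - y₁) ≡ x * x₁ - y * y₁
  split = solve-∀

≈-*-congˡ : ∀ z → x ≈ y [mod N ] → z * x ≈ z * y [mod N ]
≈-*-congˡ z = ≈-*-cong (≈-refl {x = z})

≈-*-congʳ : ∀ z → x ≈ y [mod N ] → x * z ≈ y * z [mod N ]
≈-*-congʳ z x≈y = ≈-*-cong x≈y (≈-refl {x = z})

≈-mod-∣ : M ∣ N → x ≈ y [mod N ] → x ≈ y [mod M ]
≈-mod-∣ {M = M} {N = N} (divides q N≡q*M) (mk≈ N∣x-y) =
  mk≈ (ℤ∣.∣-trans (ℤ∣.divides (+ q) (trans (cong +_ N≡q*M) (pos-* q M))) N∣x-y)

≈-mod-* : Coprime M N → x ≈ y [mod M ] → x ≈ y [mod N ] → x ≈ y [mod M ℕ.* N ]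
≈-mod-* {M = M} {N = N} M⊥N M∣x-y N∣x-y with ≈⇒≡[mod] N∣x-y
... | divides c ∣x-y∣≡c*N =
  ≡[mod]⇒≈ (subst (M ℕ.* N ∣_) (sym ∣x-y∣≡c*N) (ℕ∣.*-monoˡ-∣ N M∣c))
  where
  M∣c : M ∣ c
  M∣c = coprime-divisor M⊥N (subst (M ∣_) (trans ∣x-y∣≡c*N (ℕ.*-comm c N)) (≈⇒≡[mod] M∣x-y))

≈-mod-1 : x ≈ y [mod 1 ]
≈-mod-1 {x = x} {y = y} = mk≈ (ℤ∣.divides (x - y) (sym (*-identityʳ (x - y))))

≈-isEquivalence : IsEquivalence (λ x y → x ≈ y [mod N ])
≈-isEquivalence = record { refl = ≈-refl ; sym = ≈-sym ; trans = ≈-trans }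

≈-setoid : ℕ → Setoid _ _
≈-setoid N = record { isEquivalence = ≈-isEquivalence {N} }

module ≈-Reasoning (N : ℕ) = SetoidReasoning (≈-setoid N)

-- Units modulo N

record Unit (N : ℕ) (x : ℤ) : Set where
  constructor mkUnit
  field
    inverse : ℤ
    x*inverse≈1 : x * inverse ≈ 1ℤ [mod N ]

Unit-1 : Unit N 1ℤ
Unit-1 = mkUnit 1ℤ ≈-refl

*-cancelʳ-≈ : Unit N z → x * z ≈ y * z [mod N ] → x ≈ y [mod N ]
*-cancelʳ-≈ {N = N} {z = z} {x = x} {y = y} (mkUnit w zw≈1) xz≈yz = begin
  x            ≡⟨ sym (*-identityʳ x) ⟩
  x * 1ℤ       ≈⟨ ≈-*-congˡ x (≈-sym zw≈1) ⟩
  x * (z * w)  ≡⟨ reassoc x ⟩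
  x * z * w    ≈⟨ ≈-*-congʳ w xz≈yz ⟩
  y * z * w    ≡⟨ sym (reassoc y) ⟩
  y * (z * w)  ≈⟨ ≈-*-congˡ y zw≈1 ⟩
  y * 1ℤ       ≡⟨ *-identityʳ y ⟩
  y            ∎
  where
  open ≈-Reasoning N
  reassoc : ∀ x → x * (z * w) ≡ x * z * w
  reassoc x = sym (*-assoc x z w)

Unit-* : Unit N x → Unit N y → Unit N (x * y)
Unit-* {N = N} {x = x} {y = y} (mkUnit u xu≈1) (mkUnit v yv≈1) = mkUnit (u * v) (begin
  x * y * (u * v)    ≡⟨ interchange x y u v ⟩
  (x * u) * (y * v)  ≈⟨ ≈-*-cong xu≈1 yv≈1 ⟩
  1ℤ                 ∎)
  where
  open ≈-Reasoning N
  interchange : ∀ x y u v → x * y * (u * v) ≡ (x * u) * (y * v)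
  interchange = solve-∀

Unit-resp-≈ : x ≈ y [mod N ] → Unit N x → Unit N y
Unit-resp-≈ x≈y (mkUnit u xu≈1) = mkUnit u (≈-trans (≈-*-congʳ u (≈-sym x≈y)) xu≈1)

Unit-*⇒Unitˡ : Unit N (x * y) → Unit N x
Unit-*⇒Unitˡ {x = x} {y = y} (mkUnit w xyw≈1) =
  mkUnit (y * w) (≈-trans (≈-reflexive (sym (*-assoc x y w))) xyw≈1)

Unit-mod-∣ : M ∣ N → Unit N x → Unit M x
Unit-mod-∣ M∣N (mkUnit u xu≈1) = mkUnit u (≈-mod-∣ M∣N xu≈1)

Unit-mod-1 : Unit 1 x
Unit-mod-1 = mkUnit 0ℤ ≈-mod-1

-- If x u₁ ≡ 1 (mod M) and x u₂ ≡ 1 (mod N), then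
-- x (u₁ + u₂ − x u₁ u₂) − 1 = −(x u₁ − 1)(x u₂ − 1) ≡ 0 (mod M N).
Unit-mod-* : Unit M x → Unit N x → Unit (M ℕ.* N) x
Unit-mod-* {M = M} {x = x} {N = N}
           (mkUnit u₁ (mk≈ (ℤ∣.divides k₁ eq₁))) (mkUnit u₂ (mk≈ (ℤ∣.divides k₂ eq₂))) =
  mkUnit (u₁ + u₂ - x * u₁ * u₂) (mk≈ (ℤ∣.divides (- (k₁ * k₂)) (begin
    x * (u₁ + u₂ - x * u₁ * u₂) - 1ℤ  ≡⟨ factor x u₁ u₂ ⟩
    - ((x * u₁ - 1ℤ) * (x * u₂ - 1ℤ))  ≡⟨ cong₂ (λ a b → - (a * b)) eq₁ eq₂ ⟩
    - ((k₁ * + M) * (k₂ * + N))        ≡⟨ regroup k₁ k₂ (+ M) (+ N) ⟩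
    - (k₁ * k₂) * (+ M * + N)          ≡⟨ cong (- (k₁ * k₂) *_) (sym (pos-* M N)) ⟩
    - (k₁ * k₂) * + (M ℕ.* N)          ∎)))
  where
  open ≡-Reasoning
  factor : ∀ x u₁ u₂ → x * (u₁ + u₂ - x * u₁ * u₂) - 1ℤ ≡ - ((x * u₁ - 1ℤ) * (x * u₂ - 1ℤ))
  factor = solve-∀
  regroup : ∀ k₁ k₂ m n → - ((k₁ * m) * (k₂ * n)) ≡ - (k₁ * k₂) * (m * n)
  regroup = solve-∀

Unit[0]⇒≡1 : Unit N 0ℤ → N ≡ 1
Unit[0]⇒≡1 (mkUnit _ 0≈1) = ℕ∣.∣1⇒≡1 (≈⇒≡[mod] 0≈1)

inverses-≈ : x * u ≈ 1ℤ [mod N ] → y * v ≈ 1ℤ [mod N ] → x ≈ y [mod N ] → u ≈ v [mod N ]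
inverses-≈ {x = x} {u = u} {N = N} {y = y} {v = v} xu≈1 yv≈1 x≈y =
  *-cancelʳ-≈ (mkUnit u xu≈1) (begin
    u * x  ≡⟨ *-comm u x ⟩
    x * u  ≈⟨ xu≈1 ⟩
    1ℤ     ≈⟨ ≈-sym yv≈1 ⟩
    y * v  ≡⟨ *-comm y v ⟩
    v * y  ≈⟨ ≈-*-congˡ v (≈-sym x≈y) ⟩
    v * x  ∎)
  where open ≈-Reasoning N

InvCong⇔ : InvCong N x y ⇔ (Unit N x × Unit N y × x ≈ y [mod N ])
InvCong⇔ {N = N} {x = x} {y = y} = mk⇔ to from
  where
  to : InvCong N x y → Unit N x × Unit N y × x ≈ y [mod N ]
  to (u , v , xu≡1 , yv≡1 , u≡v) =
    mkUnit u xu≈1 , mkUnit v yv≈1 ,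
    inverses-≈ {x = u} {u = x} {y = v} {v = y} (commute x u xu≈1) (commute y v yv≈1) (≡[mod]⇒≈ u≡v)
    where
    xu≈1 : x * u ≈ 1ℤ [mod N ]
    xu≈1 = ≡[mod]⇒≈ xu≡1
    yv≈1 : y * v ≈ 1ℤ [mod N ]
    yv≈1 = ≡[mod]⇒≈ yv≡1
    commute : ∀ a b → a * b ≈ 1ℤ [mod N ] → b * a ≈ 1ℤ [mod N ]
    commute a b = ≈-trans (≈-reflexive (*-comm b a))
  from : Unit N x × Unit N y × x ≈ y [mod N ] → InvCong N x y
  from (mkUnit u xu≈1 , mkUnit v yv≈1 , x≈y) =
    u , v , ≈⇒≡[mod] xu≈1 , ≈⇒≡[mod] yv≈1 , ≈⇒≡[mod] (inverses-≈ xu≈1 yv≈1 x≈y)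

InvCong-sym : InvCong N x y → InvCong N y x
InvCong-sym (u , v , xu≡1 , yv≡1 , u≡v) =
  v , u , yv≡1 , xu≡1 , ≈⇒≡[mod] (≈-sym (≡[mod]⇒≈ {x = u} {y = v} u≡v))

InvCong-mod-1 : InvCong 1 x y
InvCong-mod-1 {x = x} {y = y} =
  Equivalence.from (InvCong⇔ {N = 1} {x = x} {y = y}) (Unit-mod-1 , Unit-mod-1 , ≈-mod-1)

InvCong-mod-* : Coprime M N → InvCong M x y → InvCong N x y → InvCong (M ℕ.* N) x y
InvCong-mod-* {M = M} {N = N} {x = x} {y = y} M⊥N invCong-M invCong-N = Equivalence.from InvCong⇔
  (combine (Equivalence.to InvCong⇔ invCong-M) (Equivalence.to InvCong⇔ invCong-N))
  where
  combine : Unit M x × Unit M y × x ≈ y [mod M ] → Unit N x × Unit N y × x ≈ y [mod N ] →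
    Unit (M ℕ.* N) x × Unit (M ℕ.* N) y × x ≈ y [mod M ℕ.* N ]
  combine (x-unit-M , y-unit-M , x≈y-M) (x-unit-N , y-unit-N , x≈y-N) =
    Unit-mod-* x-unit-M x-unit-N , Unit-mod-* y-unit-M y-unit-N , ≈-mod-* M⊥N x≈y-M x≈y-N

-- Equality up to units

infix 4 _∼_[mod_]
record _∼_[mod_] (x y : ℤ) (N : ℕ) : Set where
  constructor mk∼
  field
    σ τ : ℤ
    σ-unit : Unit N σ
    σ≈τ : σ ≈ τ [mod N ]
    x*σ≡y*τ : x * σ ≡ y * τ

∼-reflexive : x ≡ y → x ∼ y [mod N ]
∼-reflexive x≡y = mk∼ 1ℤ 1ℤ Unit-1 ≈-refl (cong (_* 1ℤ) x≡y)

∼-sym : x ∼ y [mod N ] → y ∼ x [mod N ]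
∼-sym (mk∼ s t s-unit s≈t xs≡yt) = mk∼ t s (Unit-resp-≈ s≈t s-unit) (≈-sym s≈t) (sym xs≡yt)

∼-*-cong : x ∼ y [mod N ] → x₁ ∼ y₁ [mod N ] → x * x₁ ∼ y * y₁ [mod N ]
∼-*-cong {x = x} {y = y} {x₁ = x₁} {y₁ = y₁}
         (mk∼ s₁ t₁ s₁-unit s₁≈t₁ eq₁) (mk∼ s₂ t₂ s₂-unit s₂≈t₂ eq₂) =
  mk∼ (s₁ * s₂) (t₁ * t₂) (Unit-* s₁-unit s₂-unit) (≈-*-cong s₁≈t₁ s₂≈t₂) (begin
    x * x₁ * (s₁ * s₂)    ≡⟨ interchange x x₁ s₁ s₂ ⟩
    (x * s₁) * (x₁ * s₂)  ≡⟨ cong₂ _*_ eq₁ eq₂ ⟩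
    (y * t₁) * (y₁ * t₂)  ≡⟨ interchange y y₁ t₁ t₂ ⟨
    y * y₁ * (t₁ * t₂)    ∎)
  where
  open ≡-Reasoning
  interchange : ∀ a b c d → a * b * (c * d) ≡ (a * c) * (b * d)
  interchange = solve-∀

∼-mod-∣ : M ∣ N → x ∼ y [mod N ] → x ∼ y [mod M ]
∼-mod-∣ M∣N (mk∼ s t s-unit s≈t xs≡yt) =
  mk∼ s t (Unit-mod-∣ M∣N s-unit) (≈-mod-∣ M∣N s≈t) xs≡yt

∼-*-cancelʳ : z ≢ 0ℤ → x * z ∼ y * w [mod N ] → z ∼ w [mod N ] → x ∼ y [mod N ]
∼-*-cancelʳ {z = z} {x = x} {y = y} {w = w} z≢0
            (mk∼ s t s-unit s≈t xzs≡ywt) (mk∼ s′ t′ s′-unit s′≈t′ zs′≡wt′) =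
  mk∼ (s * t′) (t * s′) (Unit-* s-unit (Unit-resp-≈ s′≈t′ s′-unit))
      (≈-*-cong s≈t (≈-sym s′≈t′))
      (*-cancelˡ-≡ z _ _ {{≢-nonZero z≢0}} (begin
        z * (x * (s * t′))  ≡⟨ regroup z x s t′ ⟩
        x * z * s * t′      ≡⟨ cong (_* t′) xzs≡ywt ⟩
        y * w * t * t′      ≡⟨ regroup′ y w t t′ ⟩
        y * t * (w * t′)    ≡⟨ cong (y * t *_) zs′≡wt′ ⟨
        y * t * (z * s′)    ≡⟨ regroup″ y t z s′ ⟩
        z * (y * (t * s′))  ∎))
  where
  open ≡-Reasoning
  regroup : ∀ z x s t′ → z * (x * (s * t′)) ≡ x * z * s * t′
  regroup = solve-∀
  regroup′ : ∀ y w t t′ → y * w * t * t′ ≡ y * t * (w * t′)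
  regroup′ = solve-∀
  regroup″ : ∀ y t z s′ → y * t * (z * s′) ≡ z * (y * (t * s′))
  regroup″ = solve-∀

-- Reduction by the gcd

x÷d*d≡x : ∀ d → + d ℤ∣.∣ x → (x ÷ + d) * + d ≡ x
x÷d*d≡x zero (ℤ∣.divides q x≡q*0) = sym (trans x≡q*0 (*-zeroʳ q))
x÷d*d≡x {x = x} d@(suc _) d∣x = remainder-0 (x ℤ.% + d) (ℤ.a≡a%n+[a/n]*n x (+ d)) (ℤ.n%d<d x (+ d))
  where
  remainder-0 : ∀ r → x ≡ + r + (x ℤ./ + d) * + d → r ℕ.< d → (x ℤ./ + d) * + d ≡ x
  remainder-0 zero x≡0+qd _ = sym (trans x≡0+qd (+-identityˡ _))
  remainder-0 r@(suc _) x≡r+qd r<d = ⊥-elim (ℕ∣.>⇒∤ r<d (ℤ∣.∣⇒∣ᵤ d∣r))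
    where
    r≡x-qd : + r ≡ x - (x ℤ./ + d) * + d
    r≡x-qd = trans (cancel (+ r) ((x ℤ./ + d) * + d)) (cong (_- (x ℤ./ + d) * + d) (sym x≡r+qd))
      where
      cancel : ∀ a b → a ≡ a + b - b
      cancel = solve-∀
    d∣r : + d ℤ∣.∣ + r
    d∣r = subst (_ ℤ∣.∣_) (sym r≡x-qd)
      (ℤ∣.∣m∣n⇒∣m-n d∣x (ℤ∣.∣n⇒∣m*n (x ℤ./ + d) ℤ∣.∣-refl))

x÷gcd*gcd≡x : ∀ x y → (x ÷ gcd x y) * gcd x y ≡ x
x÷gcd*gcd≡x x y = x÷d*d≡x _ (ℤ∣.∣ᵤ⇒∣ (gcd[i,j]∣i x y))

y÷gcd*gcd≡y : ∀ x y → (y ÷ gcd x y) * gcd x y ≡ y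
y÷gcd*gcd≡y x y = x÷d*d≡x _ (ℤ∣.∣ᵤ⇒∣ (gcd[i,j]∣j x y))

bézout-ℤ : ∀ {d m n} → Bézout.Identity d m n →
  Σ ℤ λ α → Σ ℤ λ β → α * + m + β * + n ≡ + d
bézout-ℤ {d} {m} {n} (Bézout.+- a b d+bn≡am) = + a , - + b , (begin
  + a * + m + - + b * + n          ≡⟨ cong (_+ - + b * + n) d+bn≡am′ ⟨
  (+ d + + b * + n) + - + b * + n  ≡⟨ cancel (+ d) (+ b) (+ n) ⟩
  + d                              ∎)
  where
  open ≡-Reasoning
  d+bn≡am′ : + d + + b * + n ≡ + a * + m
  d+bn≡am′ = trans (cong (_+_ (+ d)) (sym (pos-* b n)))
    (trans (sym (pos-+ d _)) (trans (cong +_ d+bn≡am) (pos-* a m)))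
  cancel : ∀ d b n → (d + b * n) + - b * n ≡ d
  cancel = solve-∀
bézout-ℤ {d} {m} {n} (Bézout.-+ a b d+am≡bn) with bézout-ℤ {d} {n} {m} (Bézout.+- b a d+am≡bn)
... | α , β , αn+βm≡d = β , α , trans (+-comm (β * + m) (α * + n)) αn+βm≡d

+∣i∣≡σ*i : ∀ i → Σ ℤ λ σ → + ∣ i ∣ ≡ σ * i
+∣i∣≡σ*i i with +∣i∣≡i⊎+∣i∣≡-i i
... | inj₁ ∣i∣≡i  = 1ℤ , trans ∣i∣≡i (sym (*-identityˡ i))
... | inj₂ ∣i∣≡-i = -1ℤ , trans ∣i∣≡-i (sym (-1*i≡-i i))

gcd-bézout : ∀ x y → Σ ℤ λ α → Σ ℤ λ β → α * x + β * y ≡ gcd x y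
gcd-bézout x y
  with bézout-ℤ (Bézout.identity (ℕ.gcd-GCD ∣ x ∣ ∣ y ∣)) | +∣i∣≡σ*i x | +∣i∣≡σ*i y
... | α , β , α∣x∣+β∣y∣≡g | σ , ∣x∣≡σx | τ , ∣y∣≡τy = α * σ , β * τ , (begin
  α * σ * x + β * τ * y          ≡⟨ cong₂ _+_ (*-assoc α σ x) (*-assoc β τ y) ⟩
  α * (σ * x) + β * (τ * y)      ≡⟨ cong₂ (λ a b → α * a + β * b) ∣x∣≡σx ∣y∣≡τy ⟨
  α * + ∣ x ∣ + β * + ∣ y ∣  ≡⟨ α∣x∣+β∣y∣≡g ⟩
  gcd x y                        ∎)
  where open ≡-Reasoning

bézout-common-factor : ∀ {s t} α β → α * x + β * y ≡ 1ℤ → x * s ≡ y * t →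
  t ≡ x * (α * t + β * s) × s ≡ y * (α * t + β * s)
bézout-common-factor {x = x} {y = y} {s} {t} α β αx+βy≡1 xs≡yt = t≡xk , s≡yk
  where
  open ≡-Reasoning
  t≡xk : t ≡ x * (α * t + β * s)
  t≡xk = begin
    t                        ≡⟨ *-identityʳ t ⟨
    t * 1ℤ                   ≡⟨ cong (t *_) αx+βy≡1 ⟨
    t * (α * x + β * y)      ≡⟨ expand t α x β y ⟩
    α * x * t + β * (y * t)  ≡⟨ cong (λ e → α * x * t + β * e) xs≡yt ⟨
    α * x * t + β * (x * s)  ≡⟨ collect x α t β s ⟩
    x * (α * t + β * s)      ∎
    where
    expand : ∀ t α x β y → t * (α * x + β * y) ≡ α * x * t + β * (y * t)
    expand = solve-∀
    collect : ∀ x α t β s → α * x * t + β * (x * s) ≡ x * (α * t + β * s)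
    collect = solve-∀
  s≡yk : s ≡ y * (α * t + β * s)
  s≡yk = begin
    s                        ≡⟨ *-identityʳ s ⟨
    s * 1ℤ                   ≡⟨ cong (s *_) αx+βy≡1 ⟨
    s * (α * x + β * y)      ≡⟨ expand s α x β y ⟩
    α * (x * s) + β * y * s  ≡⟨ cong (λ e → α * e + β * y * s) xs≡yt ⟩
    α * (y * t) + β * y * s  ≡⟨ collect y α t β s ⟩
    y * (α * t + β * s)      ∎
    where
    expand : ∀ s α x β y → s * (α * x + β * y) ≡ α * (x * s) + β * y * s
    expand = solve-∀
    collect : ∀ y α t β s → α * (y * t) + β * y * s ≡ y * (α * t + β * s)
    collect = solve-∀

gcd-nonZero : x ≢ 0ℤ → NonZero (gcd x y)
gcd-nonZero {x = x} {y = y} x≢0 = ≢-nonZero (x≢0 ∘ gcd[i,j]≡0⇒i≡0 x y)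

÷gcd-bézout : x ≢ 0ℤ → Σ ℤ λ α → Σ ℤ λ β → α * (x ÷ gcd x y) + β * (y ÷ gcd x y) ≡ 1ℤ
÷gcd-bézout {x = x} {y = y} x≢0 = α , β , *-cancelʳ-≡ _ _ γ {{gcd-nonZero {y = y} x≢0}} (begin
  (α * (x ÷ γ) + β * (y ÷ γ)) * γ
    ≡⟨ distrib α _ β _ γ ⟩
  α * ((x ÷ γ) * γ) + β * ((y ÷ γ) * γ)
    ≡⟨ cong₂ (λ a b → α * a + β * b) (x÷gcd*gcd≡x x y) (y÷gcd*gcd≡y x y) ⟩
  α * x + β * y                          ≡⟨ αx+βy≡γ ⟩
  γ                                      ≡⟨ *-identityˡ γ ⟨
  1ℤ * γ                                 ∎)
  where
  open ≡-Reasoning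
  γ = gcd x y
  α = proj₁ (gcd-bézout x y)
  β = proj₁ (proj₂ (gcd-bézout x y))
  αx+βy≡γ = proj₂ (proj₂ (gcd-bézout x y))
  distrib : ∀ α x′ β y′ γ → (α * x′ + β * y′) * γ ≡ α * (x′ * γ) + β * (y′ * γ)
  distrib = solve-∀

÷gcd-cross : x ≢ 0ℤ → x * u ≡ y * v → (x ÷ gcd x y) * u ≡ (y ÷ gcd x y) * v
÷gcd-cross {x = x} {u = u} {y = y} {v = v} x≢0 xu≡yv =
  *-cancelʳ-≡ _ _ γ {{gcd-nonZero {y = y} x≢0}} (begin
  (x ÷ γ) * u * γ  ≡⟨ swap (x ÷ γ) u γ ⟩
  (x ÷ γ) * γ * u  ≡⟨ cong (_* u) (x÷gcd*gcd≡x x y) ⟩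
  x * u            ≡⟨ xu≡yv ⟩
  y * v            ≡⟨ cong (_* v) (y÷gcd*gcd≡y x y) ⟨
  (y ÷ γ) * γ * v  ≡⟨ swap (y ÷ γ) γ v ⟩
  (y ÷ γ) * v * γ  ∎)
  where
  open ≡-Reasoning
  γ = gcd x y
  swap : ∀ a b c → a * b * c ≡ a * c * b
  swap = solve-∀

InvCong÷gcd⇒∼ : InvCong N (x ÷ gcd x y) (y ÷ gcd x y) → x ∼ y [mod N ]
InvCong÷gcd⇒∼ {N = N} {x = x} {y = y} invCong =
  mk∼ y′ x′ (proj₁ (proj₂ units)) (≈-sym (proj₂ (proj₂ units))) (begin
    x * y′             ≡⟨ cong (_* y′) (x÷gcd*gcd≡x x y) ⟨
    x′ * gcd x y * y′  ≡⟨ swap x′ (gcd x y) y′ ⟩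
    y′ * gcd x y * x′  ≡⟨ cong (_* x′) (y÷gcd*gcd≡y x y) ⟩
    y * x′             ∎)
  where
  open ≡-Reasoning
  x′ = x ÷ gcd x y
  y′ = y ÷ gcd x y
  units : Unit N x′ × Unit N y′ × x′ ≈ y′ [mod N ]
  units = Equivalence.to InvCong⇔ invCong
  swap : ∀ a g b → a * g * b ≡ b * g * a
  swap = solve-∀

-- With α x′ + β y′ = 1 and k = α t + β s one gets t = x′ k and s = y′ k: the units s ≡ t force x′, y′
-- and k to be units, and cancelling k from x′ k ≡ y′ k gives x′ ≡ y′.
∼⇒InvCong÷gcd : x ≢ 0ℤ → x ∼ y [mod N ] → InvCong N (x ÷ gcd x y) (y ÷ gcd x y)
∼⇒InvCong÷gcd {x = x} {y = y} {N = N} x≢0 (mk∼ s t s-unit s≈t xs≡yt) =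
  Equivalence.from InvCong⇔ (x′-unit , y′-unit , x′≈y′)
  where
  x′ = x ÷ gcd x y
  y′ = y ÷ gcd x y
  α = proj₁ (÷gcd-bézout {y = y} x≢0)
  β = proj₁ (proj₂ (÷gcd-bézout {y = y} x≢0))
  αx′+βy′≡1 : α * x′ + β * y′ ≡ 1ℤ
  αx′+βy′≡1 = proj₂ (proj₂ (÷gcd-bézout x≢0))
  x′s≡y′t : x′ * s ≡ y′ * t
  x′s≡y′t = ÷gcd-cross x≢0 xs≡yt
  k = α * t + β * s
  t≡x′k = proj₁ (bézout-common-factor α β αx′+βy′≡1 x′s≡y′t)
  s≡y′k = proj₂ (bézout-common-factor α β αx′+βy′≡1 x′s≡y′t)
  t-unit : Unit N t
  t-unit = Unit-resp-≈ s≈t s-unit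
  x′-unit : Unit N x′
  x′-unit = Unit-*⇒Unitˡ (subst (Unit N) t≡x′k t-unit)
  y′-unit : Unit N y′
  y′-unit = Unit-*⇒Unitˡ (subst (Unit N) s≡y′k s-unit)
  k-unit : Unit N k
  k-unit = Unit-*⇒Unitˡ (subst (Unit N) (trans t≡x′k (*-comm x′ k)) t-unit)
  x′≈y′ : x′ ≈ y′ [mod N ]
  x′≈y′ = *-cancelʳ-≈ k-unit
    (≈-trans (≈-reflexive (sym t≡x′k)) (≈-trans (≈-sym s≈t) (≈-reflexive s≡y′k)))

0÷≡0 : ∀ g → 0ℤ ÷ g ≡ 0ℤ
0÷≡0 (+ zero)  = refl
0÷≡0 +[1+ _ ]  = refl
0÷≡0 -[1+ _ ]  = refl

Unit[0÷]⇒≡1 : ∀ g → Unit N (0ℤ ÷ g) → N ≡ 1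
Unit[0÷]⇒≡1 {N = N} g = Unit[0]⇒≡1 ∘ subst (Unit N) (0÷≡0 g)

-- Finite products

∏ : ℕ → (ℕ → ℤ) → ℤ
∏ zero    f = 1ℤ
∏ (suc n) f = f 0 * ∏ n (f ∘ suc)

∏-cong : ∀ n → (∀ {i} → i ℕ.< n → f i ≡ g i) → ∏ n f ≡ ∏ n g
∏-cong zero    f≗g = refl
∏-cong (suc n) f≗g = cong₂ _*_ (f≗g ℕ.z<s) (∏-cong n (f≗g ∘ ℕ.s<s))

∏-≡1 : ∀ n → (∀ {i} → i ℕ.< n → f i ≡ 1ℤ) → ∏ n f ≡ 1ℤ
∏-≡1 zero    f≡1 = refl
∏-≡1 (suc n) f≡1 = cong₂ _*_ (f≡1 ℕ.z<s) (∏-≡1 n (f≡1 ∘ ℕ.s<s))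

∏-* : ∀ n → ∏ n (λ i → f i * g i) ≡ ∏ n f * ∏ n g
∏-* zero = refl
∏-* {f = f} {g = g} (suc n) = trans (cong (f 0 * g 0 *_) (∏-* n)) (interchange (f 0) (g 0) _ _)
  where
  interchange : ∀ a b c d → a * b * (c * d) ≡ a * c * (b * d)
  interchange = solve-∀

∏-+ : ∀ m n → ∏ (m ℕ.+ n) f ≡ ∏ m f * ∏ n (λ i → f (m ℕ.+ i))
∏-+ zero    n = sym (*-identityˡ _)
∏-+ {f = f} (suc m) n = trans (cong (f 0 *_) (∏-+ m n)) (sym (*-assoc (f 0) _ _))

∏-trailing-ones : m ℕ.≤ n → (∀ {i} → m ℕ.≤ i → i ℕ.< n → f i ≡ 1ℤ) → ∏ n f ≡ ∏ m f
∏-trailing-ones {m = m} {n = n} {f = f} m≤n ones = begin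
  ∏ n f                                    ≡⟨ cong (λ l → ∏ l f) (ℕ.m+[n∸m]≡n m≤n) ⟨
  ∏ (m ℕ.+ (n ℕ.∸ m)) f                    ≡⟨ ∏-+ m (n ℕ.∸ m) ⟩
  ∏ m f * ∏ (n ℕ.∸ m) (λ i → f (m ℕ.+ i))  ≡⟨ cong (∏ m f *_) (∏-≡1 _ (ones (ℕ.m≤m+n m _) ∘ shift)) ⟩
  ∏ m f * 1ℤ                               ≡⟨ *-identityʳ _ ⟩
  ∏ m f                                    ∎
  where
  open ≡-Reasoning
  shift : ∀ {i} → i ℕ.< n ℕ.∸ m → m ℕ.+ i ℕ.< n
  shift i<n-m = subst (_ ℕ.<_) (ℕ.m+[n∸m]≡n m≤n) (ℕ.+-monoʳ-< m i<n-m)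

∏-last : ∀ n → (∀ {i} → i ℕ.< n → f i ≡ 1ℤ) → ∏ (suc n) f ≡ f n
∏-last {f} zero    _   = *-identityʳ (f 0)
∏-last {f} (suc n) f≡1 = trans (cong₂ _*_ (f≡1 ℕ.z<s) (∏-last n (f≡1 ∘ ℕ.s<s))) (*-identityˡ _)

∏-blocks : ∀ k p → ∏ (k ℕ.* p) f ≡ ∏ k (λ j → ∏ p (λ i → f (j ℕ.* p ℕ.+ i)))
∏-blocks zero p = refl
∏-blocks {f = f} (suc k) p = trans (∏-+ p (k ℕ.* p)) (cong (∏ p f *_) (trans (∏-blocks k p)
  (∏-cong k (λ _ → ∏-cong p (λ _ → cong f (sym (ℕ.+-assoc p _ _)))))))

∏-stride : ∀ k p .{{_ : ℕ.NonZero p}} → (∀ j {i} → suc i ℕ.< p → f (j ℕ.* p ℕ.+ i) ≡ 1ℤ) →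
  ∏ (k ℕ.* p) f ≡ ∏ k (λ j → f (j ℕ.* p ℕ.+ ℕ.pred p))
∏-stride k (suc p) ones =
  trans (∏-blocks k (suc p)) (∏-cong k (λ {j} _ → ∏-last p (ones j ∘ ℕ.s<s)))

restrict : {P : Pred ℕ 0ℓ} → Decidable P → (ℕ → ℤ) → ℕ → ℤ
restrict P? f i = if does (P? i) then f i else 1ℤ

restrict-yes : ∀ (P? : Decidable P) f {i} → P i → restrict P? f i ≡ f i
restrict-yes P? f {i} Pi rewrite dec-true (P? i) Pi = refl

restrict-no : ∀ (P? : Decidable P) f {i} → ¬ P i → restrict P? f i ≡ 1ℤ
restrict-no P? f {i} ¬Pi rewrite dec-false (P? i) ¬Pi = refl

∏-partition : ∀ (P? : Decidable P) n → ∏ n f ≡ ∏ n (restrict P? f) * ∏ n (restrict (¬? ∘ P?) f)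
∏-partition {P = P} {f = f} P? n = trans (∏-cong n (λ {i} _ → split i (P? i))) (∏-* n)
  where
  split : ∀ i → Dec (P i) → f i ≡ restrict P? f i * restrict (¬? ∘ P?) f i
  split i (yes Pi) = sym (trans
    (cong₂ _*_ (restrict-yes P? f Pi) (restrict-no (¬? ∘ P?) f (λ ¬Pi → ¬Pi Pi))) (*-identityʳ (f i)))
  split i (no ¬Pi) = sym (trans
    (cong₂ _*_ (restrict-no P? f ¬Pi) (restrict-yes (¬? ∘ P?) f ¬Pi)) (*-identityˡ (f i)))

∏-≡0 : ∀ n {j} → j ℕ.< n → f j ≡ 0ℤ → ∏ n f ≡ 0ℤ
∏-≡0 {f = f} (suc n) {zero}  ℕ.z<s f0≡0 = cong (_* ∏ n (f ∘ suc)) f0≡0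
∏-≡0 {f = f} (suc n) {suc j} (ℕ.s<s j<n) fj≡0 =
  trans (cong (f 0 *_) (∏-≡0 n j<n fj≡0)) (*-zeroʳ (f 0))

*-≢0 : x ≢ 0ℤ → y ≢ 0ℤ → x * y ≢ 0ℤ
*-≢0 {x = x} x≢0 y≢0 xy≡0 with i*j≡0⇒i≡0∨j≡0 x xy≡0
... | inj₁ x≡0 = x≢0 x≡0
... | inj₂ y≡0 = y≢0 y≡0

∏-≢0 : ∀ n → (∀ {i} → i ℕ.< n → f i ≢ 0ℤ) → ∏ n f ≢ 0ℤ
∏-≢0 zero    f≢0 ()
∏-≢0 (suc n) f≢0 = *-≢0 (f≢0 ℕ.z<s) (∏-≢0 n (f≢0 ∘ ℕ.s<s))

∏-∼ : ∀ n → (∀ {i} → i ℕ.< n → f i ∼ g i [mod N ]) → ∏ n f ∼ ∏ n g [mod N ]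
∏-∼ zero    f∼g = ∼-reflexive refl
∏-∼ (suc n) f∼g = ∼-*-cong (f∼g ℕ.z<s) (∏-∼ n (f∼g ∘ ℕ.s<s))

∏-scale-at : ∀ n {j c} → j ℕ.< n → (∀ {i} → i ℕ.< n → i ≢ j → f i ≡ g i) → f j ≡ c * g j →
  ∏ n f ≡ c * ∏ n g
∏-scale-at {f} {g} (suc n) {zero} {c} ℕ.z<s f≡g fj≡cgj =
  trans (cong₂ _*_ fj≡cgj (∏-cong n (λ i<n → f≡g (ℕ.s<s i<n) (λ ())))) (*-assoc c (g 0) _)
∏-scale-at {f} {g} (suc n) {suc j} {c} (ℕ.s<s j<n) f≡g fj≡cgj = trans
  (cong₂ _*_ (f≡g ℕ.z<s (λ ()))
             (∏-scale-at n {c = c} j<n (λ i<n i≢j → f≡g (ℕ.s<s i<n) (i≢j ∘ ℕ.suc-injective)) fj≡cgj))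
  (swap (g 0) c _)
  where
  swap : ∀ a b c → a * (b * c) ≡ b * (a * c)
  swap = solve-∀

foldr-applyUpTo : ∀ {S : ℕ → ℤ → ℤ} {H : ℕ → ℤ} → (∀ i acc → S i acc ≡ H i * acc) →
  ∀ h n → foldr S 1ℤ (applyUpTo h n) ≡ ∏ n (H ∘ h)
foldr-applyUpTo S≡H* h zero    = refl
foldr-applyUpTo {H = H} S≡H* h (suc n) =
  trans (S≡H* (h 0) _) (cong (H (h 0) *_) (foldr-applyUpTo {H = H} S≡H* (h ∘ suc) n))

foldr-filter : ∀ {A B : Set} {P : Pred A 0ℓ} (P? : Decidable P) (S : A → B → B) z xs →
  foldr S z (filter P? xs) ≡ foldr (λ x acc → if does (P? x) then S x acc else acc) z xs
foldr-filter P? S z [] = refl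
foldr-filter P? S z (x ∷ xs) with does (P? x)
... | true  = cong (S x) (foldr-filter P? S z xs)
... | false = foldr-filter P? S z xs

-- Divisibility and primes

prime∤⇒coprime : Prime p → ¬ p ∣ n → Coprime p n
prime∤⇒coprime p-prime p∤n (i∣p , i∣n) with prime⇒irreducible p-prime i∣p
... | inj₁ i≡1 = i≡1
... | inj₂ refl = ⊥-elim (p∤n i∣n)

coprime-*ˡ : Coprime m n → Coprime d n → Coprime (m ℕ.* d) n
coprime-*ˡ {m = m} m⊥n d⊥n {i} (i∣md , i∣n) = d⊥n (coprime-divisor i⊥m i∣md , i∣n)
  where
  i⊥m : Coprime i m
  i⊥m (j∣i , j∣m) = m⊥n (j∣m , ℕ∣.∣-trans j∣i i∣n)

coprime-^ˡ : Coprime m n → Coprime (m ^ r) n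
coprime-^ˡ {r = zero}  m⊥n (i∣1 , _) = ℕ∣.∣1⇒≡1 i∣1
coprime-^ˡ {r = suc r} m⊥n = coprime-*ˡ m⊥n (coprime-^ˡ {r = r} m⊥n)

prime∣prime⇒≡ : Prime q → Prime p → q ∣ p → q ≡ p
prime∣prime⇒≡ q-prime p-prime q∣p with prime⇒irreducible p-prime q∣p
... | inj₁ refl = ⊥-elim (¬prime[1] q-prime)
... | inj₂ q≡p = q≡p

∣⇒nonZero : .{{ℕ.NonZero n}} → m ∣ n → ℕ.NonZero m
∣⇒nonZero {n = n} m∣n = ℕ.≢-nonZero λ { refl → ℕ.≢-nonZero⁻¹ n (ℕ∣.0∣⇒≡0 m∣n) }

prime-divisor : .{{ℕ.NonZero n}} → n ≢ 1 → Σ ℕ λ p → Prime p × p ∣ n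
prime-divisor {n} n≢1 with factorise n
... | record { factors = [] ; isFactorisation = n≡1 } = ⊥-elim (n≢1 n≡1)
... | record { factors = p ∷ ps ; isFactorisation = n≡p*∏ps ; factorsPrime = p-prime ∷ _ } =
  p , p-prime , divides (product ps) (trans n≡p*∏ps (ℕ.*-comm p (product ps)))

split-prime-power : Prime p → ∀ n → .{{ℕ.NonZero n}} →
  Σ ℕ λ r → Σ ℕ λ m → n ≡ p ^ r ℕ.* m × ¬ p ∣ m
split-prime-power {p} p-prime = <-rec Split split
  where
  Split : ℕ → Set
  Split n = .{{ℕ.NonZero n}} → Σ ℕ λ r → Σ ℕ λ m′ → n ≡ p ^ r ℕ.* m′ × ¬ p ∣ m′
  split : ∀ n → (∀ {q} → q ℕ.< n → Split q) → Split n
  split n rec with p ∣? n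
  ... | no p∤n = 0 , n , sym (ℕ.*-identityˡ n) , p∤n
  ... | yes (divides q n≡q*p) with rec q<n
    where
    instance
      q≢0 : ℕ.NonZero q
      q≢0 = ℕ.≢-nonZero λ { refl → ℕ.≢-nonZero⁻¹ n n≡q*p }
    q<n : q ℕ.< n
    q<n = subst (q ℕ.<_) (sym n≡q*p) (ℕ.m<m*n q p (ℕ.nonTrivial⇒n>1 p {{prime⇒nonTrivial p-prime}}))
  ... | r , m′ , q≡p^r*m′ , p∤m′ =
    suc r , m′ , trans n≡q*p (trans (cong (ℕ._* p) q≡p^r*m′) (rotate (p ^ r) m′ p)) , p∤m′
    where
    rotate : ∀ a b c → a ℕ.* b ℕ.* c ≡ c ℕ.* a ℕ.* b
    rotate = ℕ-solve-∀

prime∤-^ : Prime q → ¬ q ∣ p → ∀ r → ¬ q ∣ p ^ r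
prime∤-^ q-prime q∤p zero    q∣1 = ¬prime[1] (subst Prime (ℕ∣.∣1⇒≡1 q∣1) q-prime)
prime∤-^ {p = p} q-prime q∤p (suc r) q∣p*p^r with euclidsLemma p (p ^ r) q-prime q∣p*p^r
... | inj₁ q∣p   = q∤p q∣p
... | inj₂ q∣p^r = prime∤-^ q-prime q∤p r q∣p^r

prime∤-* : Prime q → ¬ q ∣ m → ¬ q ∣ n → ¬ q ∣ m ℕ.* n
prime∤-* {m = m} {n = n} q-prime q∤m q∤n q∣mn with euclidsLemma m n q-prime q∣mn
... | inj₁ q∣m = q∤m q∣m
... | inj₂ q∣n = q∤n q∣n

prime∤p^r*k : Prime p → Prime q → ¬ p ∣ m → ∀ {e k} → m ≡ q ^ suc e ℕ.* k → ¬ q ∣ k →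
  ¬ q ∣ p ^ r ℕ.* k
prime∤p^r*k {p = p} {q = q} {m = m} {r = r} p-prime q-prime p∤m {e} {k} m≡q^[1+e]*k q∤k =
  prime∤-* q-prime (prime∤-^ q-prime q∤p r) q∤k
  where
  q∣m : q ∣ m
  q∣m = subst (q ∣_) (sym m≡q^[1+e]*k) (ℕ∣.∣-trans (ℕ∣.m∣m*n (q ^ e)) (ℕ∣.m∣m*n k))
  q∤p : ¬ q ∣ p
  q∤p q∣p = p∤m (subst (_∣ m) (prime∣prime⇒≡ q-prime p-prime q∣p) q∣m)

module _ (T : ℕ → Set) (T-1 : T 1) (T-* : ∀ {m n} → Coprime m n → T m → T n → T (m ℕ.* n)) where

  prime-power-induction : ∀ n → .{{ℕ.NonZero n}} →
    (∀ {p r m} → Prime p → ¬ p ∣ m → n ≡ p ^ suc r ℕ.* m → T (p ^ suc r)) → T n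
  prime-power-induction = <-rec Goal induct
    where
    Goal : ℕ → Set
    Goal n = .{{ℕ.NonZero n}} →
      (∀ {p r m} → Prime p → ¬ p ∣ m → n ≡ p ^ suc r ℕ.* m → T (p ^ suc r)) → T n
    induct : ∀ n → (∀ {k} → k ℕ.< n → Goal k) → Goal n
    induct n rec local with n ℕ.≟ 1
    ... | yes refl = T-1
    ... | no n≢1 with prime-divisor n≢1
    ... | p , p-prime , p∣n with split-prime-power p-prime n
    ... | zero , m , n≡1*m , p∤m = ⊥-elim (p∤m (subst (p ∣_) (trans n≡1*m (ℕ.*-identityˡ m)) p∣n))
    ... | suc r , m , n≡p^[1+r]*m , p∤m =
      subst T (sym n≡p^[1+r]*m) (T-* (coprime-^ˡ {r = suc r} (prime∤⇒coprime p-prime p∤m))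
        (local {r = r} p-prime p∤m n≡p^[1+r]*m) (rec m<n (λ {q} {e} {k} → local-m {q} {e} {k})))
      where
      instance
        m≢0 : ℕ.NonZero m
        m≢0 = ℕ.≢-nonZero λ { refl → ℕ.≢-nonZero⁻¹ n (trans n≡p^[1+r]*m (ℕ.*-zeroʳ (p ^ suc r))) }
        p≢0 : ℕ.NonZero p
        p≢0 = prime⇒nonZero p-prime
      1<p^[1+r] : 1 ℕ.< p ^ suc r
      1<p^[1+r] = ℕ.<-≤-trans (ℕ.nonTrivial⇒n>1 p {{prime⇒nonTrivial p-prime}})
                              (ℕ.m≤m*n p (p ^ r) {{ℕ.m^n≢0 p r}})
      m<n : m ℕ.< n
      m<n = subst (m ℕ.<_) (trans (ℕ.*-comm m _) (sym n≡p^[1+r]*m)) (ℕ.m<m*n m (p ^ suc r) 1<p^[1+r])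
      local-m : ∀ {q e k} → Prime q → ¬ q ∣ k → m ≡ q ^ suc e ℕ.* k → T (q ^ suc e)
      local-m {q} {e} {k} q-prime q∤k m≡q^[1+e]*k =
        local {r = e} q-prime (prime∤p^r*k {r = suc r} p-prime q-prime p∤m {e} {k} m≡q^[1+e]*k q∤k) (begin
          n                                  ≡⟨ n≡p^[1+r]*m ⟩
          p ^ suc r ℕ.* m                    ≡⟨ cong (p ^ suc r ℕ.*_) m≡q^[1+e]*k ⟩
          p ^ suc r ℕ.* (q ^ suc e ℕ.* k)    ≡⟨ swap (p ^ suc r) (q ^ suc e) k ⟩
          q ^ suc e ℕ.* (p ^ suc r ℕ.* k)    ∎)
        where
        open ≡-Reasoning
        swap : ∀ a b c → a ℕ.* (b ℕ.* c) ≡ b ℕ.* (a ℕ.* c)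
        swap = ℕ-solve-∀

-- The Möbius function

μ≡∏ : ∀ n → μ n ≡ ∏ n (λ i → μ-factor n (suc i))
μ≡∏ n = foldr-applyUpTo (λ _ _ → refl) id n

μ-factor-∤ : ¬ q ∣ n → μ-factor n q ≡ 1ℤ
μ-factor-∤ {q} {n} q∤n with prime? q
... | no _ = refl
... | yes _ with (q ^ 2) ∣? n
...   | yes q²∣n = ⊥-elim (q∤n (ℕ∣.∣-trans (ℕ∣.m∣m*n (q ^ 1)) q²∣n))
...   | no _ with q ∣? n
...     | yes q∣n = ⊥-elim (q∤n q∣n)
...     | no _ = refl

μ-factor-p² : Prime p → p ^ 2 ∣ n → μ-factor n p ≡ 0ℤ
μ-factor-p² {p} {n} p-prime p²∣n with prime? p
... | no ¬p-prime = ⊥-elim (¬p-prime p-prime)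
... | yes _ with (p ^ 2) ∣? n
...   | yes _ = refl
...   | no p²∤n = ⊥-elim (p²∤n p²∣n)

μ-factor-p : Prime p → ¬ p ^ 2 ∣ n → p ∣ n → μ-factor n p ≡ -1ℤ
μ-factor-p {p} {n} p-prime p²∤n p∣n with prime? p
... | no ¬p-prime = ⊥-elim (¬p-prime p-prime)
... | yes _ with (p ^ 2) ∣? n
...   | yes p²∣n = ⊥-elim (p²∤n p²∣n)
...   | no _ with p ∣? n
...     | yes _ = refl
...     | no p∤n = ⊥-elim (p∤n p∣n)

μ-factor-cong : (Prime q → ((q ^ 2 ∣ m) ⇔ (q ^ 2 ∣ n)) × ((q ∣ m) ⇔ (q ∣ n))) →
  μ-factor m q ≡ μ-factor n q
μ-factor-cong {q} {m} {n} same with prime? q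
... | no _ = refl
... | yes q-prime with (q ^ 2) ∣? m | (q ^ 2) ∣? n | proj₁ (same q-prime) | proj₂ (same q-prime)
...   | yes _     | yes _     | _ | _ = refl
...   | yes q²∣m  | no q²∤n   | sq | _ = ⊥-elim (q²∤n (Equivalence.to sq q²∣m))
...   | no q²∤m   | yes q²∣n  | sq | _ = ⊥-elim (q²∤m (Equivalence.from sq q²∣n))
...   | no _      | no _      | _ | dv with q ∣? m | q ∣? n
...     | yes _   | yes _   = refl
...     | yes q∣m | no q∤n  = ⊥-elim (q∤n (Equivalence.to dv q∣m))
...     | no q∤m  | yes q∣n = ⊥-elim (q∤m (Equivalence.from dv q∣n))
...     | no _    | no _    = refl

μ≡0 : .{{ℕ.NonZero n}} → Prime p → p ^ 2 ∣ n → μ n ≡ 0ℤ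
μ≡0 {p = zero} p-prime _ = ⊥-elim (¬prime[0] p-prime)
μ≡0 {n} {suc p′} p-prime p²∣n = trans (μ≡∏ n) (∏-≡0 n p′<n (μ-factor-p² p-prime p²∣n))
  where
  p′<n : p′ ℕ.< n
  p′<n = ℕ∣.∣⇒≤ (ℕ∣.∣-trans (ℕ∣.m∣m*n (suc p′ ^ 1)) p²∣n)

μ[d*p]≡-μ[d] : .{{ℕ.NonZero d}} → Prime p → ¬ p ∣ d → μ (d ℕ.* p) ≡ - μ d
μ[d*p]≡-μ[d] {p = zero} p-prime _ = ⊥-elim (¬prime[0] p-prime)
μ[d*p]≡-μ[d] {d} {p@(suc p′)} p-prime p∤d = begin
  μ (d ℕ.* p)              ≡⟨ μ≡∏ (d ℕ.* p) ⟩
  ∏ (d ℕ.* p) F            ≡⟨ ∏-scale-at (d ℕ.* p) {c = -1ℤ} p′<dp F≡G Fp′≡-Gp′ ⟩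
  -1ℤ * ∏ (d ℕ.* p) G      ≡⟨ cong (-1ℤ *_) (∏-trailing-ones (ℕ.m≤m*n d p) G≡1) ⟩
  -1ℤ * ∏ d G              ≡⟨ cong (-1ℤ *_) (μ≡∏ d) ⟨
  -1ℤ * μ d                ≡⟨ -1*i≡-i (μ d) ⟩
  - μ d                    ∎
  where
  open ≡-Reasoning
  F G : ℕ → ℤ
  F i = μ-factor (d ℕ.* p) (suc i)
  G i = μ-factor d (suc i)
  p′<dp : p′ ℕ.< d ℕ.* p
  p′<dp = ℕ.m≤n*m p d
  p²∤dp : ¬ p ^ 2 ∣ d ℕ.* p
  p²∤dp p²∣dp =
    p∤d (ℕ∣.*-cancelʳ-∣ p (subst (_∣ d ℕ.* p) (cong (p ℕ.*_) (ℕ.*-identityʳ p)) p²∣dp))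
  Fp′≡-Gp′ : F p′ ≡ -1ℤ * G p′
  Fp′≡-Gp′ = trans (μ-factor-p p-prime p²∤dp (ℕ∣.n∣m*n d)) (cong (-1ℤ *_) (sym (μ-factor-∤ p∤d)))
  F≡G : ∀ {i} → i ℕ.< d ℕ.* p → i ≢ p′ → F i ≡ G i
  F≡G {i} _ i≢p′ = μ-factor-cong λ q-prime →
    let q⊥p = prime∤⇒coprime q-prime (i≢p′ ∘ ℕ.suc-injective ∘ prime∣prime⇒≡ q-prime p-prime) in
    mk⇔ (cancel-p (coprime-^ˡ {r = 2} q⊥p)) (ℕ∣.∣m⇒∣m*n p) ,
    mk⇔ (cancel-p q⊥p) (ℕ∣.∣m⇒∣m*n p)
    where
    cancel-p : ∀ {e} → Coprime e p → e ∣ d ℕ.* p → e ∣ d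
    cancel-p {e} e⊥p e∣dp = coprime-divisor e⊥p (subst (e ∣_) (ℕ.*-comm d p) e∣dp)
  G≡1 : ∀ {i} → d ℕ.≤ i → i ℕ.< d ℕ.* p → G i ≡ 1ℤ
  G≡1 d≤i _ = μ-factor-∤ (ℕ∣.>⇒∤ (ℕ.s≤s d≤i))

-- The products A⁺ and A⁻

-- A[ s ] b n = ∏_{d ∣ n, μ(d) = s} b (n / d); the divisor d = suc i sits at index i < n.
opaque
  A-factor : ℤ → (ℕ → ℤ) → ℕ → ℕ → ℤ
  A-factor s b n i =
    if does (suc i ∣? n) then (if does (μ (suc i) ≟ s) then b (n / suc i) else 1ℤ) else 1ℤ

A[_] : ℤ → (ℕ → ℤ) → ℕ → ℤ
A[ s ] b n = ∏ n (A-factor s b n)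

opaque
  unfolding A-factor

  A-factor-yes : suc i ∣ n → μ (suc i) ≡ s → A-factor s b n i ≡ b (n / suc i)
  A-factor-yes {i = i} {n = n} {s = s} d∣n μ≡s
    rewrite dec-true (suc i ∣? n) d∣n | dec-true (μ (suc i) ≟ s) μ≡s = refl

  A-factor-no : ¬ (suc i ∣ n × μ (suc i) ≡ s) → A-factor s b n i ≡ 1ℤ
  A-factor-no {i = i} {n = n} {s = s} {b = b} ¬both = by-cases (suc i ∣? n) (μ (suc i) ≟ s)
    where
    by-cases : Dec (suc i ∣ n) → Dec (μ (suc i) ≡ s) → A-factor s b n i ≡ 1ℤ
    by-cases (no d∤n) _ rewrite dec-false (suc i ∣? n) d∤n = refl
    by-cases (yes d∣n) (no μ≢s)
      rewrite dec-true (suc i ∣? n) d∣n | dec-false (μ (suc i) ≟ s) μ≢s = refl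
    by-cases (yes d∣n) (yes μ≡s) = ⊥-elim (¬both (d∣n , μ≡s))

A-factor-cong : (suc i ∣ n × μ (suc i) ≡ s) ⇔ (suc j ∣ m × μ (suc j) ≡ s′) →
  (suc j ∣ m → μ (suc j) ≡ s′ → b (n / suc i) ≡ c (m / suc j)) →
  A-factor s b n i ≡ A-factor s′ c m j
A-factor-cong {i = i} {n = n} {s = s} {b = b} {c = c} same values with suc i ∣? n ×-dec μ (suc i) ≟ s
... | yes (d∣n , μ≡s) with Equivalence.to same (d∣n , μ≡s)
...   | d′∣m , μ′≡s′ =
  trans (A-factor-yes {b = b} d∣n μ≡s)
        (trans (values d′∣m μ′≡s′) (sym (A-factor-yes {b = c} d′∣m μ′≡s′)))
A-factor-cong {b = b} {c = c} same values | no ¬both =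
  trans (A-factor-no {b = b} ¬both) (sym (A-factor-no {b = c} (¬both ∘ Equivalence.from same)))

A-factor-∼ : (suc i ∣ n → μ (suc i) ≡ s → b (n / suc i) ∼ c (n / suc i) [mod N ]) →
  A-factor s b n i ∼ A-factor s c n i [mod N ]
A-factor-∼ {i = i} {n = n} {s = s} {b = b} {c = c} values with suc i ∣? n ×-dec μ (suc i) ≟ s
... | yes (d∣n , μ≡s) =
  subst₂ _∼_[mod _ ] (sym (A-factor-yes {b = b} d∣n μ≡s)) (sym (A-factor-yes {b = c} d∣n μ≡s))
    (values d∣n μ≡s)
... | no ¬both =
  subst₂ _∼_[mod _ ] (sym (A-factor-no {b = b} ¬both)) (sym (A-factor-no {b = c} ¬both)) (∼-reflexive refl)

A-factor-≢0 : (suc i ∣ n → b (n / suc i) ≢ 0ℤ) → A-factor s b n i ≢ 0ℤ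
A-factor-≢0 {i = i} {n = n} {b = b} {s = s} value≢0 with suc i ∣? n ×-dec μ (suc i) ≟ s
... | yes (d∣n , μ≡s) = subst (_≢ 0ℤ) (sym (A-factor-yes {b = b} d∣n μ≡s)) (value≢0 d∣n)
... | no ¬both = subst (_≢ 0ℤ) (sym (A-factor-no {b = b} ¬both)) (λ ())

A-tail[_] : ℤ → (ℕ → ℤ) → ℕ → ℤ
A-tail[ s ] b m = ∏ (ℕ.pred m) (A-factor s b m ∘ suc)

A[1]≡head*tail : .{{ℕ.NonZero m}} → A[ 1ℤ ] b m ≡ b m * A-tail[ 1ℤ ] b m
A[1]≡head*tail {m = suc m′} {b = b} =
  cong (_* A-tail[ 1ℤ ] b (suc m′))
       (trans (A-factor-yes (ℕ∣.1∣ suc m′) refl) (cong b (ℕ.n/1≡n (suc m′))))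

A[-1]≡tail : .{{ℕ.NonZero m}} → A[ -1ℤ ] b m ≡ A-tail[ -1ℤ ] b m
A[-1]≡tail {m = suc m′} {b = b} =
  trans (cong (_* A-tail[ -1ℤ ] b (suc m′)) (A-factor-no (λ { (_ , ()) }))) (*-identityˡ _)

A-tail-∼ : (∀ {k} → k ℕ.< m → k ∣ m → b k ∼ c k [mod N ]) →
  A-tail[ s ] b m ∼ A-tail[ s ] c m [mod N ]
A-tail-∼ {m = zero}  b∼c = ∼-reflexive refl
A-tail-∼ {m = suc m′} b∼c = ∏-∼ m′ (λ {i} _ → A-factor-∼ λ d∣m _ →
  b∼c (ℕ.m/n<m (suc m′) (suc (suc i)) (ℕ.s<s ℕ.z<s)) (ℕ∣.m/n∣m d∣m))

A-tail-≢0 : (∀ {k} → k ∣ m → b k ≢ 0ℤ) → A-tail[ s ] b m ≢ 0ℤ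
A-tail-≢0 {m = m} b≢0 = ∏-≢0 (ℕ.pred m) (λ _ → A-factor-≢0 (b≢0 ∘ ℕ∣.m/n∣m))

A-≢0 : (∀ {k} → k ∣ m → b k ≢ 0ℤ) → A[ s ] b m ≢ 0ℤ
A-≢0 {m = m} b≢0 = ∏-≢0 m (λ _ → A-factor-≢0 (b≢0 ∘ ℕ∣.m/n∣m))

fold≡A[_] : ∀ s a n →
  foldr (λ i acc → if does (μ (suc i) ≟ s) then a (n / suc i) * acc else acc) 1ℤ
        (filter (λ i → suc i ∣? n) (upTo n))
  ≡ A[ s ] a n
fold≡A[ s ] a n =
  trans (foldr-filter (λ i → suc i ∣? n) _ 1ℤ (upTo n)) (foldr-applyUpTo {H = A-factor s a n} step id n)
  where
  S : ℕ → ℤ → ℤ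
  S i acc = if does (suc i ∣? n) then (if does (μ (suc i) ≟ s) then a (n / suc i) * acc else acc) else acc
  step : ∀ i acc → S i acc ≡ A-factor s a n i * acc
  step i acc = by-cases (suc i ∣? n) (μ (suc i) ≟ s)
    where
    by-cases : Dec (suc i ∣ n) → Dec (μ (suc i) ≡ s) → S i acc ≡ A-factor s a n i * acc
    by-cases (no d∤n) _ rewrite dec-false (suc i ∣? n) d∤n =
      sym (trans (cong (_* acc) (A-factor-no (d∤n ∘ proj₁))) (*-identityˡ acc))
    by-cases (yes d∣n) (no μ≢s) rewrite dec-true (suc i ∣? n) d∣n | dec-false (μ (suc i) ≟ s) μ≢s =
      sym (trans (cong (_* acc) (A-factor-no (μ≢s ∘ proj₂))) (*-identityˡ acc))
    by-cases (yes d∣n) (yes μ≡s) rewrite dec-true (suc i ∣? n) d∣n | dec-true (μ (suc i) ≟ s) μ≡s =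
      sym (cong (_* acc) (A-factor-yes d∣n μ≡s))

A⁺≡A[1] : ∀ a n → A⁺ a n ≡ A[ 1ℤ ] a n
A⁺≡A[1] = fold≡A[ 1ℤ ]

A⁻≡A[-1] : ∀ a n → A⁻ a n ≡ A[ -1ℤ ] a n
A⁻≡A[-1] = fold≡A[ -1ℤ ]

module PrimePowerSplit (a : ℕ → ℤ) {p r m : ℕ} .{{_ : ℕ.NonZero m}} (p-prime : Prime p) (p∤m : ¬ p ∣ m)
  where

  private instance
    p≢0 : ℕ.NonZero p
    p≢0 = prime⇒nonZero p-prime

  n₀ K : ℕ
  n₀ = p ^ suc r ℕ.* m
  K = p ^ r ℕ.* m

  B C : ℕ → ℤ
  B x = a (p ^ suc r ℕ.* x)
  C x = a (p ^ r ℕ.* x)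

  p∣1+? : Decidable (λ i → p ∣ suc i)
  p∣1+? i = p ∣? suc i

  private
    ∣p^k*x⇒∣x : ∀ k {x} → ¬ p ∣ d → d ∣ p ^ k ℕ.* x → d ∣ x
    ∣p^k*x⇒∣x k p∤d =
      coprime-divisor (Coprimality.sym (coprime-^ˡ {r = k} (prime∤⇒coprime p-prime p∤d)))

    ∤m : p ∣ d → ¬ d ∣ m
    ∤m p∣d d∣m = p∤m (ℕ∣.∣-trans p∣d d∣m)

    ≥m⇒∤m : m ℕ.≤ i → ¬ suc i ∣ m
    ≥m⇒∤m m≤i = ℕ∣.>⇒∤ (ℕ.s≤s m≤i)

  coprime-part : ∏ n₀ (restrict (¬? ∘ p∣1+?) (A-factor s a n₀)) ≡ A[ s ] B m
  coprime-part {s} = begin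
    ∏ n₀ (restrict (¬? ∘ p∣1+?) (A-factor s a n₀))
      ≡⟨ ∏-cong n₀ (λ {i} _ → pointwise i (p∣1+? i)) ⟩
    ∏ n₀ (A-factor s B m)
      ≡⟨ ∏-trailing-ones m≤n₀ (λ m≤i _ → A-factor-no (≥m⇒∤m m≤i ∘ proj₁)) ⟩
    A[ s ] B m
      ∎
    where
    open ≡-Reasoning
    m≤n₀ : m ℕ.≤ n₀
    m≤n₀ = ℕ.m≤n*m m (p ^ suc r) {{ℕ.m^n≢0 p (suc r)}}
    pointwise : ∀ i → Dec (p ∣ suc i) → restrict (¬? ∘ p∣1+?) (A-factor s a n₀) i ≡ A-factor s B m i
    pointwise i (yes p∣d) = trans (restrict-no (¬? ∘ p∣1+?) (A-factor s a n₀) (λ p∤d → p∤d p∣d))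
                                  (sym (A-factor-no (∤m p∣d ∘ proj₁)))
    pointwise i (no p∤d) = trans (restrict-yes (¬? ∘ p∣1+?) (A-factor s a n₀) p∤d)
      (A-factor-cong (mk⇔ (map₁ (∣p^k*x⇒∣x (suc r) p∤d)) (map₁ (ℕ∣.∣n⇒∣m*n (p ^ suc r))))
                     (λ d∣m _ → cong a (ℕ.*-/-assoc (p ^ suc r) d∣m)))

  n₀≡K*p : n₀ ≡ K ℕ.* p
  n₀≡K*p = rotate p (p ^ r) m
    where
    rotate : ∀ p q m → p ℕ.* q ℕ.* m ≡ q ℕ.* m ℕ.* p
    rotate = ℕ-solve-∀

  1+[j*p+p-1]≡[1+j]*p : ∀ j → suc (j ℕ.* p ℕ.+ ℕ.pred p) ≡ suc j ℕ.* p
  1+[j*p+p-1]≡[1+j]*p j = trans (sym (ℕ.+-suc (j ℕ.* p) _))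
    (trans (cong (j ℕ.* p ℕ.+_) (ℕ.suc-pred p)) (ℕ.+-comm (j ℕ.* p) p))

  p∤1+[j*p+i] : ∀ j {i} → suc i ℕ.< p → ¬ p ∣ suc (j ℕ.* p ℕ.+ i)
  p∤1+[j*p+i] j {i} 1+i<p p∣ = ℕ.<⇒≱ 1+i<p (ℕ∣.∣⇒≤ p∣1+i)
    where
    p∣1+i : p ∣ suc i
    p∣1+i = ℕ∣.∣m+n∣m⇒∣n (subst (p ∣_) (sym (ℕ.+-suc (j ℕ.* p) i)) p∣) (ℕ∣.n∣m*n j)

  A-factor-at-p-multiple : s ≢ 0ℤ → ∀ j →
    A-factor s a n₀ (j ℕ.* p ℕ.+ ℕ.pred p) ≡ A-factor (- s) C m j
  A-factor-at-p-multiple {s} s≢0 j = by-cases (p ∣? suc j)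
    where
    e = suc j
    Cond : ℕ → Set
    Cond d = d ∣ n₀ × μ d ≡ s
    divisor≡e*p = 1+[j*p+p-1]≡[1+j]*p j
    by-cases : Dec (p ∣ e) → A-factor s a n₀ (j ℕ.* p ℕ.+ ℕ.pred p) ≡ A-factor (- s) C m j
    by-cases (yes p∣e) =
      trans (A-factor-no (s≢0 ∘ μ≡s⇒s≡0 ∘ proj₂)) (sym (A-factor-no (∤m p∣e ∘ proj₁)))
      where
      μ[e*p]≡0 : μ (e ℕ.* p) ≡ 0ℤ
      μ[e*p]≡0 = μ≡0 {{ℕ.m*n≢0 e p}} p-prime
        (subst (_∣ e ℕ.* p) (cong (p ℕ.*_) (sym (ℕ.*-identityʳ p))) (ℕ∣.*-monoˡ-∣ p p∣e))
      μ≡s⇒s≡0 : μ (suc (j ℕ.* p ℕ.+ ℕ.pred p)) ≡ s → s ≡ 0ℤ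
      μ≡s⇒s≡0 μ≡s = trans (sym μ≡s) (trans (cong μ divisor≡e*p) μ[e*p]≡0)
    by-cases (no p∤e) =
      A-factor-cong (mk⇔ (to ∘ subst Cond divisor≡e*p) (subst Cond (sym divisor≡e*p) ∘ from)) values
      where
      μ[e*p]≡-μ[e] : μ (e ℕ.* p) ≡ - μ e
      μ[e*p]≡-μ[e] = μ[d*p]≡-μ[d] p-prime p∤e
      to : Cond (e ℕ.* p) → e ∣ m × μ e ≡ - s
      to (ep∣n₀ , μ≡s) =
        ∣p^k*x⇒∣x r p∤e (ℕ∣.*-cancelʳ-∣ p (subst (e ℕ.* p ∣_) n₀≡K*p ep∣n₀)) ,
        trans (sym (neg-involutive (μ e))) (cong -_ (trans (sym μ[e*p]≡-μ[e]) μ≡s))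
      from : e ∣ m × μ e ≡ - s → Cond (e ℕ.* p)
      from (e∣m , μ≡-s) =
        subst (e ℕ.* p ∣_) (sym n₀≡K*p) (ℕ∣.*-monoˡ-∣ p (ℕ∣.∣n⇒∣m*n (p ^ r) e∣m)) ,
        trans μ[e*p]≡-μ[e] (trans (cong -_ μ≡-s) (neg-involutive s))
      values : e ∣ m → μ e ≡ - s → a (n₀ / suc (j ℕ.* p ℕ.+ ℕ.pred p)) ≡ C (m / e)
      values e∣m _ = cong a (begin
        n₀ / suc (j ℕ.* p ℕ.+ ℕ.pred p)  ≡⟨ ℕ./-congʳ {o = e ℕ.* p} divisor≡e*p ⟩
        n₀ / (e ℕ.* p)                   ≡⟨ ℕ./-congˡ {o = e ℕ.* p} n₀≡K*p ⟩
        K ℕ.* p / (e ℕ.* p)              ≡⟨ ℕ.m*n/o*n≡m/o K p e ⟩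
        K / e                            ≡⟨ ℕ.*-/-assoc (p ^ r) e∣m ⟩
        p ^ r ℕ.* (m / e)                ∎)
        where
        open ≡-Reasoning
        instance
          e*p≢0 : ℕ.NonZero (e ℕ.* p)
          e*p≢0 = ℕ.m*n≢0 e p

  p-part : s ≢ 0ℤ → ∏ n₀ (restrict p∣1+? (A-factor s a n₀)) ≡ A[ - s ] C m
  p-part {s} s≢0 = begin
    ∏ n₀ (restrict p∣1+? φ)
      ≡⟨ cong (λ l → ∏ l (restrict p∣1+? φ)) n₀≡K*p ⟩
    ∏ (K ℕ.* p) (restrict p∣1+? φ)
      ≡⟨ ∏-stride K p (λ j 1+i<p → restrict-no p∣1+? φ (p∤1+[j*p+i] j 1+i<p)) ⟩
    ∏ K (λ j → restrict p∣1+? φ (j ℕ.* p ℕ.+ ℕ.pred p))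
      ≡⟨ ∏-cong K (λ {j} _ → trans (restrict-yes p∣1+? φ (p∣ j)) (A-factor-at-p-multiple s≢0 j)) ⟩
    ∏ K (A-factor (- s) C m)
      ≡⟨ ∏-trailing-ones m≤K (λ m≤j _ → A-factor-no (≥m⇒∤m m≤j ∘ proj₁)) ⟩
    A[ - s ] C m
      ∎
    where
    open ≡-Reasoning
    φ = A-factor s a n₀
    p∣ : ∀ j → p ∣ suc (j ℕ.* p ℕ.+ ℕ.pred p)
    p∣ j = subst (p ∣_) (sym (1+[j*p+p-1]≡[1+j]*p j)) (ℕ∣.n∣m*n (suc j))
    m≤K : m ℕ.≤ K
    m≤K = ℕ.m≤n*m m (p ^ r) {{ℕ.m^n≢0 p r}}

  A-split : s ≢ 0ℤ → A[ s ] a n₀ ≡ A[ s ] B m * A[ - s ] C m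
  A-split {s} s≢0 = begin
    A[ s ] a n₀
      ≡⟨ ∏-partition p∣1+? n₀ ⟩
    ∏ n₀ (restrict p∣1+? φ) * ∏ n₀ (restrict (¬? ∘ p∣1+?) φ)
      ≡⟨ *-comm (∏ n₀ (restrict p∣1+? φ)) _ ⟩
    ∏ n₀ (restrict (¬? ∘ p∣1+?) φ) * ∏ n₀ (restrict p∣1+? φ)
      ≡⟨ cong₂ _*_ coprime-part (p-part s≢0) ⟩
    A[ s ] B m * A[ - s ] C m
      ∎
    where
    open ≡-Reasoning
    φ = A-factor s a n₀

  A⁺-split : A⁺ a n₀ ≡ B m * (A-tail[ 1ℤ ] B m * A-tail[ -1ℤ ] C m)
  A⁺-split = begin
    A⁺ a n₀                                       ≡⟨ A⁺≡A[1] a n₀ ⟩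
    A[ 1ℤ ] a n₀                                  ≡⟨ A-split (λ ()) ⟩
    A[ 1ℤ ] B m * A[ -1ℤ ] C m                    ≡⟨ cong₂ _*_ (A[1]≡head*tail {b = B}) (A[-1]≡tail {b = C}) ⟩
    B m * A-tail[ 1ℤ ] B m * A-tail[ -1ℤ ] C m    ≡⟨ *-assoc (B m) _ _ ⟩
    B m * (A-tail[ 1ℤ ] B m * A-tail[ -1ℤ ] C m)  ∎
    where open ≡-Reasoning

  A⁻-split : A⁻ a n₀ ≡ C m * (A-tail[ 1ℤ ] C m * A-tail[ -1ℤ ] B m)
  A⁻-split = begin
    A⁻ a n₀                                       ≡⟨ A⁻≡A[-1] a n₀ ⟩
    A[ -1ℤ ] a n₀                                 ≡⟨ A-split (λ ()) ⟩
    A[ -1ℤ ] B m * A[ 1ℤ ] C m                    ≡⟨ cong₂ _*_ (A[-1]≡tail {b = B}) (A[1]≡head*tail {b = C}) ⟩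
    A-tail[ -1ℤ ] B m * (C m * A-tail[ 1ℤ ] C m)  ≡⟨ rotate (A-tail[ -1ℤ ] B m) (C m) _ ⟩
    C m * (A-tail[ 1ℤ ] C m * A-tail[ -1ℤ ] B m)  ∎
    where
    open ≡-Reasoning
    rotate : ∀ x y z → x * (y * z) ≡ y * (z * x)
    rotate = solve-∀

-- Strong Euler–Gauss sequences

PrimePowerEG : (ℕ → ℤ) → Set
PrimePowerEG a = (p r m : ℕ) → Prime p → 1 ℕ.≤ r → 1 ℕ.≤ m →
  InvCong (p ^ r)
    (a (p ^ r ℕ.* m) ÷ gcd (a (p ^ r ℕ.* m)) (a (p ^ (r ℕ.∸ 1) ℕ.* m)))
    (a (p ^ (r ℕ.∸ 1) ℕ.* m) ÷ gcd (a (p ^ r ℕ.* m)) (a (p ^ (r ℕ.∸ 1) ℕ.* m)))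

-- A zero term a k would make A⁻ a (2 k) vanish, through the divisor 2 of 2 k.
StrongEG⇒≢0 : StrongEG a → ∀ k → .{{ℕ.NonZero k}} → a k ≢ 0ℤ
StrongEG⇒≢0 {a} strongEG k ak≡0 = ℕ.<⇒≢ 1<n₀ (sym (Unit[0÷]⇒≡1 γ 0÷γ-unit))
  where
  n₀ = k ℕ.* 2
  γ = gcd (A⁺ a n₀) (A⁻ a n₀)
  instance
    n₀≢0 : ℕ.NonZero n₀
    n₀≢0 = ℕ.m*n≢0 k 2
  1<n₀ : 1 ℕ.< n₀
  1<n₀ = ℕ.m≤n*m 2 k
  A⁻≡0 : A⁻ a n₀ ≡ 0ℤ
  A⁻≡0 = trans (A⁻≡A[-1] a n₀)
    (∏-≡0 n₀ 1<n₀ (trans (A-factor-yes (ℕ∣.n∣m*n k) refl) (trans (cong a (ℕ.m*n/n≡m k 2)) ak≡0)))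
  A⁻÷γ-unit : Unit n₀ (A⁻ a n₀ ÷ γ)
  A⁻÷γ-unit = proj₁ (Equivalence.to (InvCong⇔ {y = A⁺ a n₀ ÷ γ}) (strongEG n₀ (ℕ.>-nonZero⁻¹ n₀)))
  0÷γ-unit : Unit n₀ (0ℤ ÷ γ)
  0÷γ-unit = subst (λ z → Unit n₀ (z ÷ γ)) A⁻≡0 A⁻÷γ-unit

-- A zero term a k would make a (2⁰ k) / gcd vanish modulo 2.
PrimePowerEG⇒≢0 : PrimePowerEG a → ∀ k → .{{ℕ.NonZero k}} → a k ≢ 0ℤ
PrimePowerEG⇒≢0 {a} primePowerEG k ak≡0 = 2≢1 (Unit[0÷]⇒≡1 γ 0÷γ-unit)
  where
  2≢1 : 2 ≢ 1
  2≢1 ()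
  γ = gcd (a (2 ℕ.* k)) (a (1 ℕ.* k))
  a[k]÷γ-unit : Unit 2 (a (1 ℕ.* k) ÷ γ)
  a[k]÷γ-unit = proj₁ (proj₂ (Equivalence.to (InvCong⇔ {x = a (2 ℕ.* k) ÷ γ})
    (primePowerEG 2 1 k prime[2] ℕ.≤-refl (ℕ.>-nonZero⁻¹ k))))
  0÷γ-unit : Unit 2 (0ℤ ÷ γ)
  0÷γ-unit = subst (λ z → Unit 2 (z ÷ γ)) (trans (cong a (ℕ.*-identityˡ k)) ak≡0) a[k]÷γ-unit

module _ {a : ℕ → ℤ} (strongEG : StrongEG a) where

  private
    a≢0 : ∀ n → .{{ℕ.NonZero n}} → a n ≢ 0ℤ
    a≢0 = StrongEG⇒≢0 strongEG

  StrongEG⇒A⁺∼A⁻ : ∀ n → .{{ℕ.NonZero n}} → A⁺ a n ∼ A⁻ a n [mod n ]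
  StrongEG⇒A⁺∼A⁻ n =
    InvCong÷gcd⇒∼ (InvCong-sym {x = A⁻ a n ÷ γ} {y = A⁺ a n ÷ γ} (strongEG n (ℕ.>-nonZero⁻¹ n)))
    where γ = gcd (A⁺ a n) (A⁻ a n)

  StrongEG⇒a[p^[1+r]*m]∼a[p^r*m] : Prime p → ∀ r m → .{{ℕ.NonZero m}} → ¬ p ∣ m →
    a (p ^ suc r ℕ.* m) ∼ a (p ^ r ℕ.* m) [mod p ^ suc r ]
  StrongEG⇒a[p^[1+r]*m]∼a[p^r*m] {p} p-prime r = <-rec Goal step
    where
    instance
      p≢0 : ℕ.NonZero p
      p≢0 = prime⇒nonZero p-prime
    Goal : ℕ → Set
    Goal m = .{{ℕ.NonZero m}} → ¬ p ∣ m → a (p ^ suc r ℕ.* m) ∼ a (p ^ r ℕ.* m) [mod p ^ suc r ]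
    step : ∀ m → (∀ {k} → k ℕ.< m → Goal k) → Goal m
    step m rec p∤m =
      ∼-*-cancelʳ tails≢0 (subst₂ _∼_[mod p ^ suc r ] A⁺-split A⁻-split A⁺∼A⁻-mod-p^[1+r]) tails∼
      where
      open PrimePowerSplit a {r = r} p-prime p∤m
      B∼C : ∀ {k} → k ℕ.< m → k ∣ m → B k ∼ C k [mod p ^ suc r ]
      B∼C k<m k∣m = rec k<m {{∣⇒nonZero k∣m}} (λ p∣k → p∤m (ℕ∣.∣-trans p∣k k∣m))
      tails∼ :
        A-tail[ 1ℤ ] B m * A-tail[ -1ℤ ] C m ∼ A-tail[ 1ℤ ] C m * A-tail[ -1ℤ ] B m [mod p ^ suc r ]
      tails∼ = ∼-*-cong (A-tail-∼ B∼C) (∼-sym (A-tail-∼ B∼C))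
      a[p^k*d]≢0 : ∀ k {d} → d ∣ m → a (p ^ k ℕ.* d) ≢ 0ℤ
      a[p^k*d]≢0 k {d} d∣m =
        a≢0 (p ^ k ℕ.* d) {{ℕ.m*n≢0 (p ^ k) d {{ℕ.m^n≢0 p k}} {{∣⇒nonZero d∣m}}}}
      tails≢0 : A-tail[ 1ℤ ] B m * A-tail[ -1ℤ ] C m ≢ 0ℤ
      tails≢0 = *-≢0 (A-tail-≢0 (a[p^k*d]≢0 (suc r))) (A-tail-≢0 (a[p^k*d]≢0 r))
      A⁺∼A⁻-mod-p^[1+r] : A⁺ a n₀ ∼ A⁻ a n₀ [mod p ^ suc r ]
      A⁺∼A⁻-mod-p^[1+r] =
        ∼-mod-∣ (ℕ∣.m∣m*n m) (StrongEG⇒A⁺∼A⁻ n₀ {{ℕ.m*n≢0 (p ^ suc r) m {{ℕ.m^n≢0 p (suc r)}}}})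

  StrongEG⇒PrimePowerEG : PrimePowerEG a
  StrongEG⇒PrimePowerEG p (suc r) m p-prime _ 1≤m =
    ∼⇒InvCong÷gcd {x = a (p ^ suc r ℕ.* m)} {y = a (p ^ r ℕ.* m)}
      (a≢0 (p ^ suc r ℕ.* m) {{ℕ.m*n≢0 (p ^ suc r) m {{ℕ.m^n≢0 p (suc r)}}}})
      (via-p-free-part (split-prime-power p-prime m))
    where
    instance
      p≢0 : ℕ.NonZero p
      p≢0 = prime⇒nonZero p-prime
      m≢0 : ℕ.NonZero m
      m≢0 = ℕ.>-nonZero 1≤m
    p^k*[p^e*m′]≡p^[k+e]*m′ : ∀ k e m′ → p ^ k ℕ.* (p ^ e ℕ.* m′) ≡ p ^ (k ℕ.+ e) ℕ.* m′
    p^k*[p^e*m′]≡p^[k+e]*m′ k e m′ =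
      trans (sym (ℕ.*-assoc (p ^ k) (p ^ e) m′)) (cong (ℕ._* m′) (sym (ℕ.^-distribˡ-+-* p k e)))
    via-p-free-part : (Σ ℕ λ e → Σ ℕ λ m′ → m ≡ p ^ e ℕ.* m′ × ¬ p ∣ m′) →
      a (p ^ suc r ℕ.* m) ∼ a (p ^ r ℕ.* m) [mod p ^ suc r ]
    via-p-free-part (e , m′ , m≡p^e*m′ , p∤m′) =
      subst₂ (λ x y → a x ∼ a y [mod p ^ suc r ])
        (sym (trans (cong (p ^ suc r ℕ.*_) m≡p^e*m′) (p^k*[p^e*m′]≡p^[k+e]*m′ (suc r) e m′)))
        (sym (trans (cong (p ^ r ℕ.*_) m≡p^e*m′) (p^k*[p^e*m′]≡p^[k+e]*m′ r e m′)))
        (∼-mod-∣ p^[1+r]∣p^[1+r+e]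
          (StrongEG⇒a[p^[1+r]*m]∼a[p^r*m] p-prime (r ℕ.+ e) m′ {{m′≢0}} p∤m′))
      where
      m′≢0 : ℕ.NonZero m′
      m′≢0 = ∣⇒nonZero (subst (m′ ∣_) (sym m≡p^e*m′) (ℕ∣.n∣m*n (p ^ e)))
      p^[1+r]∣p^[1+r+e] : p ^ suc r ∣ p ^ suc (r ℕ.+ e)
      p^[1+r]∣p^[1+r+e] =
        subst (p ^ suc r ∣_) (sym (ℕ.^-distribˡ-+-* p (suc r) e)) (ℕ∣.m∣m*n (p ^ e))

module _ {a : ℕ → ℤ} (primePowerEG : PrimePowerEG a) where

  private
    a≢0 : ∀ n → .{{ℕ.NonZero n}} → a n ≢ 0ℤ
    a≢0 = PrimePowerEG⇒≢0 primePowerEG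

  PrimePowerEG⇒a[p^[1+r]*m]∼a[p^r*m] :
    Prime p → ∀ r m → .{{ℕ.NonZero m}} → a (p ^ suc r ℕ.* m) ∼ a (p ^ r ℕ.* m) [mod p ^ suc r ]
  PrimePowerEG⇒a[p^[1+r]*m]∼a[p^r*m] {p} p-prime r m =
    InvCong÷gcd⇒∼ (primePowerEG p (suc r) m p-prime (ℕ.s≤s ℕ.z≤n) (ℕ.>-nonZero⁻¹ m))

  PrimePowerEG⇒A⁺∼A⁻ : Prime p → ¬ p ∣ m → .{{ℕ.NonZero m}} → ∀ r →
    A⁺ a (p ^ suc r ℕ.* m) ∼ A⁻ a (p ^ suc r ℕ.* m) [mod p ^ suc r ]
  PrimePowerEG⇒A⁺∼A⁻ {p} {m} p-prime p∤m r =
    subst₂ _∼_[mod p ^ suc r ] (sym A⁺-split) (sym A⁻-split)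
      (∼-*-cong (B∼C ℕ∣.∣-refl)
                (∼-*-cong (A-tail-∼ (λ _ → B∼C)) (∼-sym (A-tail-∼ (λ _ → B∼C)))))
    where
    open PrimePowerSplit a {r = r} p-prime p∤m
    B∼C : ∀ {k} → k ∣ m → B k ∼ C k [mod p ^ suc r ]
    B∼C {k} k∣m = PrimePowerEG⇒a[p^[1+r]*m]∼a[p^r*m] p-prime r k {{∣⇒nonZero k∣m}}

  PrimePowerEG⇒StrongEG : StrongEG a
  PrimePowerEG⇒StrongEG n 1≤n =
    InvCong-sym {x = A⁺ a n ÷ γ} {y = A⁻ a n ÷ γ} (prime-power-induction T
      (InvCong-mod-1 {x = A⁺ a n ÷ γ} {y = A⁻ a n ÷ γ})
      (λ {M} {N} → InvCong-mod-* {M = M} {N = N} {x = A⁺ a n ÷ γ} {y = A⁻ a n ÷ γ})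
      n (λ {p} {r} {m} → local {p} {r} {m}))
    where
    instance
      n≢0 : ℕ.NonZero n
      n≢0 = ℕ.>-nonZero 1≤n
    γ = gcd (A⁺ a n) (A⁻ a n)
    T : ℕ → Set
    T N = InvCong N (A⁺ a n ÷ γ) (A⁻ a n ÷ γ)
    A⁺≢0 : A⁺ a n ≢ 0ℤ
    A⁺≢0 = subst (_≢ 0ℤ) (sym (A⁺≡A[1] a n)) (A-≢0 (λ k∣n → a≢0 _ {{∣⇒nonZero k∣n}}))
    local : ∀ {p r m} → Prime p → ¬ p ∣ m → n ≡ p ^ suc r ℕ.* m → T (p ^ suc r)
    local {p} {r} {m} p-prime p∤m n≡p^[1+r]*m =
      ∼⇒InvCong÷gcd {x = A⁺ a n} {y = A⁻ a n} {N = p ^ suc r} A⁺≢0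
        (subst (λ n → A⁺ a n ∼ A⁻ a n [mod p ^ suc r ]) (sym n≡p^[1+r]*m)
               (PrimePowerEG⇒A⁺∼A⁻ p-prime p∤m {{m≢0}} r))
      where
      m≢0 : ℕ.NonZero m
      m≢0 = ∣⇒nonZero (subst (m ∣_) (sym n≡p^[1+r]*m) (ℕ∣.n∣m*n (p ^ suc r)))

lemma1 : (a : ℕ → ℤ) →
    StrongEG a ⇔
    ((p r m : ℕ) → Prime p → 1 ℕ.≤ r → 1 ℕ.≤ m →
      InvCong (p ^ r)
        (a (p ^ r ℕ.* m) ÷ gcd (a (p ^ r ℕ.* m)) (a (p ^ (r ℕ.∸ 1) ℕ.* m)))
        (a (p ^ (r ℕ.∸ 1) ℕ.* m) ÷ gcd (a (p ^ r ℕ.* m)) (a (p ^ (r ℕ.∸ 1) ℕ.* m))))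
lemma1 a = mk⇔ (StrongEG⇒PrimePowerEG {a}) (PrimePowerEG⇒StrongEG {a})
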